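{- Let $n\ge 2$. If $\mathcal H$ is a family of Hamiltonian paths on an $n$-element vertex set such that the union of any two distinct members of $\mathcal H$ contains a Hamiltonian cycle on that vertex set, then $|\mathcal H|\le\binom{n}{2}$.
   Context: A Hamiltonian path on a vertex set $V$ is a spanning path of the complete graph on $V$, regarded as an unordered edge set. The union of two graphs on $V$ is the graph on $V$ with the union of their edge sets. A Hamiltonian cycle on $V$ is a cycle through all vertices of $V$. -}

module Defs where

open import Data.Nat using (ℕ; suc; _≤_; _∸_)
open import Data.Fin using (Fin; toℕ)
open import Data.Fin.Permutation using (Permutation′; _⟨$⟩ʳ_)
open import Data.Bool using (Bool; true; _∨_)
open import Data.Product using (Σ; ∃; _×_)
open import Data.Sum using (_⊎_)
open import Relation.Binary.PropositionalEquality using (_≡_)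
open import Relation.Nullary using (¬_)

-- A graph on the vertex set Fin n, given by its edge indicator
-- (an edge set; the Hamiltonian-path predicate forces symmetry/irreflexivity).
Graph : ℕ → Set
Graph n = Fin n → Fin n → Bool

_∪ᴳ_ : ∀ {n} → Graph n → Graph n → Graph n
(G ∪ᴳ H) u v = G u v ∨ H u v

Distinct : ∀ {n} → Graph n → Graph n → Set
Distinct G H = ¬ (∀ u v → G u v ≡ H u v)

ConsecutiveIn : ∀ {n} → Permutation′ n → Fin n → Fin n → Set
ConsecutiveIn {n} π u v =
  Σ (Fin n) λ i → Σ (Fin n) λ j → (toℕ j ≡ suc (toℕ i)) ×
    (((π ⟨$⟩ʳ i) ≡ u × (π ⟨$⟩ʳ j) ≡ v) ⊎ ((π ⟨$⟩ʳ i) ≡ v × (π ⟨$⟩ʳ j) ≡ u))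

IsHamPath : ∀ {n} → Graph n → Set
IsHamPath {n} G = Σ (Permutation′ n) λ π →
  ∀ u v → (G u v ≡ true → ConsecutiveIn π u v) × (ConsecutiveIn π u v → G u v ≡ true)

CycNext : ∀ {n} → Fin n → Fin n → Set
CycNext {n} i j = (toℕ j ≡ suc (toℕ i)) ⊎ ((toℕ i ≡ n ∸ 1) × (toℕ j ≡ 0))

HasHamCycle : ∀ {n} → Graph n → Set
HasHamCycle {n} G = (3 ≤ n) × Σ (Permutation′ n) λ σ →
  ∀ i j → CycNext i j → G (σ ⟨$⟩ʳ i) (σ ⟨$⟩ʳ j) ≡ true

-- A Hamiltonian path has two end vertices, each with a unique neighbour,
-- which gives two "pendant arcs" (end, neighbour) per path.  If two distinct
-- paths of the family shared a pendant arc (v , w), then v would still have w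
-- as its only neighbour in their union, which therefore has no Hamiltonian
-- cycle.  So the 2|ℋ| pendant arcs are pairwise distinct ordered pairs of
-- distinct vertices, whence 2|ℋ| ≤ n(n - 1) = 2 (n C 2).
module Submission where

open import Defs
open import Data.Bool using (true; false; _∨_)
open import Data.Bool.Properties using (∨-zeroʳ)
open import Data.Empty using (⊥; ⊥-elim)
open import Data.Fin using (Fin; zero; suc; _<_; toℕ; fromℕ; inject₁; lower₁; punchOut; combine)
open import Data.Fin.Patterns using (0F; 1F)
open import Data.Fin.Permutation using (Permutation′; _⟨$⟩ʳ_; _⟨$⟩ˡ_; inverseˡ; inverseʳ)
open import Data.Fin.Properties
  using (toℕ-injective; toℕ-fromℕ; toℕ-inject₁; toℕ-lower₁; toℕ<n; <-cmp;
         punchOut-injective; combine-injective; injective⇒≤)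
open import Data.List using (List; []; _∷_; _++_; length; lookup)
open import Data.List.Membership.Propositional using (_∈_)
open import Data.List.Membership.Propositional.Properties using (∈-lookup)
open import Data.List.Relation.Unary.Any using (here; there)
open import Data.List.Relation.Unary.All as All using (All; []; _∷_)
import Data.List.Relation.Unary.All.Properties as All
open import Data.List.Relation.Unary.AllPairs using (AllPairs; []; _∷_)
import Data.List.Relation.Unary.AllPairs.Properties as AllPairs
open import Data.Nat using (ℕ; suc; 2+; _+_; _*_; _≤_; s≤s; z<s)
open import Data.Nat.Combinatorics using (_C_; nC1≡n; nCk+nC[k+1]≡[n+1]C[k+1])
open import Data.Nat.Properties
  using (_≟_; suc-injective; 1+n≢n; m≢1+n+m; <⇒≢; <-trans;
         *-distribˡ-+; *-suc; *-cancelˡ-≤; module ≤-Reasoning)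
open import Data.Nat.Tactic.RingSolver using (solve-∀)
open import Data.Product using (Σ-syntax; ∃; ∃-syntax; _×_; _,_; proj₁; proj₂)
open import Data.Sum using (_⊎_; inj₁; inj₂; [_,_]′)
open import Function.Base using (_∘_)
open import Function.Bundles using (Injection)
open import Function.Properties.Inverse using (↔⇒↣)
open import Relation.Binary.Definitions using (Symmetric; tri<; tri≈; tri>)
open import Relation.Binary.PropositionalEquality
  using (_≡_; _≢_; refl; sym; trans; cong; subst; module ≡-Reasoning)
open import Relation.Nullary using (¬_; yes; no)

private
  variable
    n : ℕ
    G : Graph n

Edge : Graph n → Fin n → Fin n → Set
Edge G u v = G u v ≡ true

record Pendant (G : Graph n) (v w : Fin n) : Set where
  constructor pendant
  field
    edge : Edge G v w
    only : ∀ {x} → Edge G v x → x ≡ w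

∨≡true⁻ : ∀ {a b} → a ∨ b ≡ true → a ≡ true ⊎ b ≡ true
∨≡true⁻ {true}  _   = inj₁ refl
∨≡true⁻ {false} b≡t = inj₂ b≡t

∨≡true⁺ˡ : ∀ {a b} → a ≡ true → a ∨ b ≡ true
∨≡true⁺ˡ refl = refl

∨≡true⁺ʳ : ∀ {a b} → b ≡ true → a ∨ b ≡ true
∨≡true⁺ʳ {a} refl = ∨-zeroʳ a

∪-symmetric : ∀ {n} {G H : Graph n} →
  Symmetric (Edge G) → Symmetric (Edge H) → Symmetric (Edge (G ∪ᴳ H))
∪-symmetric symG symH e =
  [ (λ g → ∨≡true⁺ˡ (symG g)) , (λ h → ∨≡true⁺ʳ (symH h)) ]′ (∨≡true⁻ e)

pendant-∪ : ∀ {n} {G H : Graph n} {v w} → Pendant G v w → Pendant H v w → Pendant (G ∪ᴳ H) v w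
pendant-∪ (pendant vw onlyG) (pendant _ onlyH) =
  pendant (∨≡true⁺ˡ vw) (λ e → [ onlyG , onlyH ]′ (∨≡true⁻ e))

permute-injective : (π : Permutation′ n) {i j : Fin n} → π ⟨$⟩ʳ i ≡ π ⟨$⟩ʳ j → i ≡ j
permute-injective π = Injection.injective (↔⇒↣ π)

cycSuccessor : ∀ {m} (i : Fin (suc m)) → ∃ (CycNext i)
cycSuccessor {m} i with m ≟ toℕ i
... | yes m≡i = zero , inj₂ (sym m≡i , refl)
... | no  m≢i = suc (lower₁ i m≢i) , inj₁ (cong suc (toℕ-lower₁ i m≢i))

cycPredecessor : ∀ {m} (j : Fin (suc m)) → ∃ λ i → CycNext i j
cycPredecessor {m} zero    = fromℕ m , inj₂ (toℕ-fromℕ m , refl)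
cycPredecessor     (suc j) = inject₁ j , inj₁ (cong suc (sym (toℕ-inject₁ j)))

CycNext-asym : ∀ {m} {i j : Fin (suc m)} → 2 ≤ m → CycNext i j → ¬ CycNext j i
CycNext-asym {i = i} _ (inj₁ j≡1+i) (inj₁ i≡1+j) =
  m≢1+n+m (toℕ i) (trans i≡1+j (cong suc j≡1+i))
CycNext-asym 2≤m (inj₁ j≡1+i) (inj₂ (j≡m , i≡0)) =
  <⇒≢ 2≤m (trans (sym (cong suc i≡0)) (trans (sym j≡1+i) j≡m))
CycNext-asym 2≤m (inj₂ (i≡m , j≡0)) (inj₁ i≡1+j) =
  <⇒≢ 2≤m (trans (sym (cong suc j≡0)) (trans (sym i≡1+j) i≡m))
CycNext-asym 2≤m (inj₂ (i≡m , _)) (inj₂ (_ , i≡0)) =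
  <⇒≢ (<-trans z<s 2≤m) (trans (sym i≡0) i≡m)

-- The cycle enters and leaves v through two different vertices, both of which
-- must then be the only neighbour w.
hamCycle⇒¬pendant : ∀ {n} {G : Graph n} {v w} →
  Symmetric (Edge G) → HasHamCycle G → ¬ Pendant G v w
hamCycle⇒¬pendant {suc m} {G} {v} {w} symG (s≤s 2≤m , σ , cycEdge) (pendant _ only) =
  neighbours-differ (cycSuccessor i) (cycPredecessor i)
  where
  i = σ ⟨$⟩ˡ v

  neighbours-differ : ∃ (CycNext i) → ∃ (λ p → CycNext p i) → ⊥
  neighbours-differ (s , i→s) (p , p→i) =
    CycNext-asym 2≤m i→s (subst (λ q → CycNext q i) (sym s≡p) p→i)
    where
    σs≡w : σ ⟨$⟩ʳ s ≡ w
    σs≡w = only (subst (λ y → Edge G y (σ ⟨$⟩ʳ s)) (inverseʳ σ) (cycEdge i s i→s))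
    σp≡w : σ ⟨$⟩ʳ p ≡ w
    σp≡w = only (symG (subst (Edge G (σ ⟨$⟩ʳ p)) (inverseʳ σ) (cycEdge p i p→i)))
    s≡p : s ≡ p
    s≡p = permute-injective σ (trans σs≡w (sym σp≡w))

shared-pendant⇒¬hamCycle : ∀ {n} {G H : Graph n} {v w} →
  Symmetric (Edge G) → Symmetric (Edge H) →
  Pendant G v w → Pendant H v w → ¬ HasHamCycle (G ∪ᴳ H)
shared-pendant⇒¬hamCycle {G = G} {H} symG symH pG pH cycle =
  hamCycle⇒¬pendant (∪-symmetric {G = G} {H} symG symH) cycle (pendant-∪ pG pH)

module _ (π : Permutation′ n) where

  consecutive-sym : ∀ {u v} → ConsecutiveIn π u v → ConsecutiveIn π v u
  consecutive-sym (i , j , j≡1+i , inj₁ ends) = i , j , j≡1+i , inj₂ ends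
  consecutive-sym (i , j , j≡1+i , inj₂ ends) = i , j , j≡1+i , inj₁ ends

  consecutive⇒≢ : ∀ {u v} → ConsecutiveIn π u v → u ≢ v
  consecutive⇒≢ (i , j , j≡1+i , inj₁ (refl , refl)) πi≡πj =
    1+n≢n (trans (sym j≡1+i) (cong toℕ (sym (permute-injective π πi≡πj))))
  consecutive⇒≢ (i , j , j≡1+i , inj₂ (refl , refl)) πj≡πi =
    1+n≢n (trans (sym j≡1+i) (cong toℕ (permute-injective π πj≡πi)))

  consecutive⇒adjacent : ∀ {i x} → ConsecutiveIn π (π ⟨$⟩ʳ i) x →
    toℕ (π ⟨$⟩ˡ x) ≡ suc (toℕ i) ⊎ toℕ i ≡ suc (toℕ (π ⟨$⟩ˡ x))
  consecutive⇒adjacent (i , j , j≡1+i , inj₁ (πi≡πi′ , refl))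
    with refl ← permute-injective π πi≡πi′ rewrite inverseˡ π {j} = inj₁ j≡1+i
  consecutive⇒adjacent (i , j , j≡1+i , inj₂ (refl , πj≡πi′))
    with refl ← permute-injective π πj≡πi′ rewrite inverseˡ π {i} = inj₂ j≡1+i

  at-position : ∀ {x i} → toℕ (π ⟨$⟩ˡ x) ≡ toℕ i → x ≡ π ⟨$⟩ʳ i
  at-position x≡i = trans (sym (inverseʳ π)) (cong (π ⟨$⟩ʳ_) (toℕ-injective x≡i))

hamPath-symmetric : IsHamPath G → Symmetric (Edge G)
hamPath-symmetric (π , edge⇔) uv = proj₂ (edge⇔ _ _) (consecutive-sym π (proj₁ (edge⇔ _ _) uv))

hamPath-irreflexive : IsHamPath G → ∀ {u v} → Edge G u v → u ≢ v
hamPath-irreflexive (π , edge⇔) uv = consecutive⇒≢ π (proj₁ (edge⇔ _ _) uv)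

Arc : ℕ → Set
Arc n = Σ[ v ∈ Fin n ] Σ[ w ∈ Fin n ] v ≢ w

SameEnds Apart : Arc n → Arc n → Set
SameEnds (v , w , _) (v′ , w′ , _) = v ≡ v′ × w ≡ w′
Apart a b = ¬ SameEnds a b

PendantArc : Graph n → Arc n → Set
PendantArc G (v , w , _) = Pendant G v w

pendantArc : ∀ {n} {G : Graph n} → IsHamPath G → ∀ {v w} → Pendant G v w → Arc n
pendantArc hp {v} {w} p = v , w , hamPath-irreflexive hp (Pendant.edge p)

-- The head is recorded by punching out the tail, so that arcs of Fin (suc m)
-- land injectively in Fin (suc m) × Fin m.
encode : ∀ {m} → Arc (suc m) → Fin (suc m * m)
encode (v , w , v≢w) = combine v (punchOut v≢w)

encode-injective : ∀ {m} (a b : Arc (suc m)) → encode a ≡ encode b → SameEnds a b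
encode-injective (v , w , v≢w) (v′ , w′ , v′≢w′) eq with combine-injective v _ v′ _ eq
... | refl , pw≡pw′ = refl , punchOut-injective v≢w v′≢w′ pw≡pw′

apart⇒encode≢ : ∀ {m} {a b : Arc (suc m)} → Apart a b → encode a ≢ encode b
apart⇒encode≢ {a = a} {b} apart = apart ∘ encode-injective a b

AllPairs-lookup : ∀ {a ℓ} {A : Set a} {R : A → A → Set ℓ} {xs : List A} → AllPairs R xs →
  ∀ {i j} → i < j → R (lookup xs i) (lookup xs j)
AllPairs-lookup (rx ∷ _)  {zero}  {suc j} _         = All.lookup rx (∈-lookup j)
AllPairs-lookup (_ ∷ rxs) {suc i} {suc j} (s≤s i<j) = AllPairs-lookup rxs i<j

AllPairs⇒length≤ : ∀ {a ℓ} {A : Set a} {R : A → A → Set ℓ} {m} (f : A → Fin m) →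
  (∀ {x y} → R x y → f x ≢ f y) → ∀ {xs} → AllPairs R xs → length xs ≤ m
AllPairs⇒length≤ f separates {xs} rxs = injective⇒≤ injective
  where
  injective : ∀ {i j} → f (lookup xs i) ≡ f (lookup xs j) → i ≡ j
  injective {i} {j} eq with <-cmp i j
  ... | tri< i<j _ _ = ⊥-elim (separates (AllPairs-lookup rxs i<j) eq)
  ... | tri≈ _ i≡j _ = i≡j
  ... | tri> _ _ j<i = ⊥-elim (separates (AllPairs-lookup rxs j<i) (sym eq))

PairwiseHamCycle : List (Graph n) → Set
PairwiseHamCycle ℋ = ∀ {G H} → G ∈ ℋ → H ∈ ℋ → Distinct G H → HasHamCycle (G ∪ᴳ H)

module _ {m : ℕ} where

  lastF secondLastF : Fin (2+ m)
  lastF       = fromℕ (suc m)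
  secondLastF = inject₁ (fromℕ m)

  first-pendant : {G : Graph (2+ m)} (hp : IsHamPath G) →
    Pendant G (proj₁ hp ⟨$⟩ʳ 0F) (proj₁ hp ⟨$⟩ʳ 1F)
  first-pendant {G} (π , edge⇔) =
    pendant (proj₂ (edge⇔ _ _) (0F , 1F , refl , inj₁ (refl , refl))) only
    where
    only : ∀ {x} → Edge G (π ⟨$⟩ʳ 0F) x → x ≡ π ⟨$⟩ʳ 1F
    only e with consecutive⇒adjacent π (proj₁ (edge⇔ _ _) e)
    ... | inj₁ x≡1 = at-position π x≡1
    ... | inj₂ ()

  last-pendant : {G : Graph (2+ m)} (hp : IsHamPath G) →
    Pendant G (proj₁ hp ⟨$⟩ʳ lastF) (proj₁ hp ⟨$⟩ʳ secondLastF)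
  last-pendant {G} (π , edge⇔) =
    pendant (proj₂ (edge⇔ _ _) (secondLastF , lastF , last≡1+secondLast , inj₂ (refl , refl))) only
    where
    last≡1+secondLast : toℕ lastF ≡ suc (toℕ secondLastF)
    last≡1+secondLast = cong suc (sym (toℕ-inject₁ (fromℕ m)))
    only : ∀ {x} → Edge G (π ⟨$⟩ʳ lastF) x → x ≡ π ⟨$⟩ʳ secondLastF
    only {x} e with consecutive⇒adjacent π (proj₁ (edge⇔ _ _) e)
    ... | inj₁ x≡2+m =
      ⊥-elim (<⇒≢ (toℕ<n (π ⟨$⟩ˡ x)) (trans x≡2+m (cong (λ k → 2+ k) (toℕ-fromℕ m))))
    ... | inj₂ 1+m≡1+x =
      at-position π (trans (sym (suc-injective 1+m≡1+x)) (sym (toℕ-inject₁ (fromℕ m))))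

  endArcs : {G : Graph (2+ m)} → IsHamPath G → List (Arc (2+ m))
  endArcs hp = pendantArc hp (first-pendant hp) ∷ pendantArc hp (last-pendant hp) ∷ []

  endArcs-pendant : {G : Graph (2+ m)} (hp : IsHamPath G) → All (PendantArc G) (endArcs hp)
  endArcs-pendant hp = first-pendant hp ∷ last-pendant hp ∷ []

  endArcs-apart : {G : Graph (2+ m)} (hp : IsHamPath G) → AllPairs Apart (endArcs hp)
  endArcs-apart (π , _) = (first≢last ∘ proj₁ ∷ []) ∷ [] ∷ []
    where
    first≢last : π ⟨$⟩ʳ 0F ≢ π ⟨$⟩ʳ lastF
    first≢last first≡last with permute-injective π first≡last
    ... | ()

  familyArcs : (ℋ : List (Graph (2+ m))) → All IsHamPath ℋ → List (Arc (2+ m))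
  familyArcs []      []         = []
  familyArcs (_ ∷ ℋ) (hp ∷ hps) = endArcs hp ++ familyArcs ℋ hps

  length-familyArcs : (ℋ : List (Graph (2+ m))) (hps : All IsHamPath ℋ) →
    length (familyArcs ℋ hps) ≡ 2 * length ℋ
  length-familyArcs []      []        = refl
  length-familyArcs (_ ∷ ℋ) (_ ∷ hps) =
    trans (cong (λ k → 2+ k) (length-familyArcs ℋ hps)) (sym (*-suc 2 (length ℋ)))

  familyArcs-pendant : (ℋ : List (Graph (2+ m))) (hps : All IsHamPath ℋ) →
    All (λ a → ∃[ H ] H ∈ ℋ × PendantArc H a) (familyArcs ℋ hps)
  familyArcs-pendant []      []         = []
  familyArcs-pendant (G ∷ ℋ) (hp ∷ hps) =
    All.++⁺ (All.map (λ p → G , here refl , p) (endArcs-pendant hp))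
            (All.map (λ (H , H∈ℋ , p) → H , there H∈ℋ , p) (familyArcs-pendant ℋ hps))

  familyArcs-apart : (ℋ : List (Graph (2+ m))) (hps : All IsHamPath ℋ) →
    AllPairs Distinct ℋ → PairwiseHamCycle ℋ → AllPairs Apart (familyArcs ℋ hps)
  familyArcs-apart []      []         []               _      = []
  familyArcs-apart (G ∷ ℋ) (hp ∷ hps) (G≠ℋ ∷ distinct) cycles =
    AllPairs.++⁺ (endArcs-apart hp)
      (familyArcs-apart ℋ hps distinct (λ G∈ℋ H∈ℋ → cycles (there G∈ℋ) (there H∈ℋ)))
      (All.map (λ {a} pa → All.map (λ {b} → apart a b pa) (familyArcs-pendant ℋ hps))
               (endArcs-pendant hp))
    where
    apart : ∀ a b → PendantArc G a → ∃[ H ] H ∈ ℋ × PendantArc H b → Apart a b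
    apart (_ , _ , _) (_ , _ , _) pa (H , H∈ℋ , pb) (refl , refl) =
      shared-pendant⇒¬hamCycle (hamPath-symmetric hp) (hamPath-symmetric (All.lookup hps H∈ℋ))
        pa pb (cycles (here refl) (there H∈ℋ) (All.lookup G≠ℋ H∈ℋ))

2*[1+n]C2≡[1+n]*n : ∀ n → 2 * (suc n C 2) ≡ suc n * n
2*[1+n]C2≡[1+n]*n 0       = refl
2*[1+n]C2≡[1+n]*n (suc n) = begin
  2 * (2+ n C 2)                 ≡⟨ cong (2 *_) (sym (nCk+nC[k+1]≡[n+1]C[k+1] (suc n) 1)) ⟩
  2 * (suc n C 1 + suc n C 2)    ≡⟨ cong (λ c → 2 * (c + suc n C 2)) (nC1≡n (suc n)) ⟩
  2 * (suc n + suc n C 2)        ≡⟨ *-distribˡ-+ 2 (suc n) (suc n C 2) ⟩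
  2 * suc n + 2 * (suc n C 2)    ≡⟨ cong (2 * suc n +_) (2*[1+n]C2≡[1+n]*n n) ⟩
  2 * suc n + suc n * n          ≡⟨ rearrange n ⟩
  2+ n * suc n                   ∎
  where
  open ≡-Reasoning
  rearrange : ∀ n → 2 * suc n + suc n * n ≡ 2+ n * suc n
  rearrange = solve-∀

claim3p1 : (n : ℕ) → 2 ≤ n → (ℋ : List (Graph n)) →
    AllPairs Distinct ℋ → All IsHamPath ℋ →
    (∀ {G H} → G ∈ ℋ → H ∈ ℋ → Distinct G H → HasHamCycle (G ∪ᴳ H)) →
    length ℋ ≤ n C 2
claim3p1 (suc 0) (s≤s ()) _ _ _ _
claim3p1 (2+ m) _ ℋ distinct paths cycles = *-cancelˡ-≤ 2 (begin
  2 * length ℋ                 ≡⟨ sym (length-familyArcs ℋ paths) ⟩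
  length (familyArcs ℋ paths)  ≤⟨ AllPairs⇒length≤ encode apart⇒encode≢
                                    (familyArcs-apart ℋ paths distinct cycles) ⟩
  2+ m * suc m                 ≡⟨ sym (2*[1+n]C2≡[1+n]*n (suc m)) ⟩
  2 * (2+ m C 2)               ∎)
  where open ≤-Reasoning
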